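{- The Petersen graph is triangle-free, $P_5$-constrained, and not equistarable.
   Context: A graph is $P_5$-constrained if the middle vertex of every (not necessarily induced) path on $5$ vertices has degree at least $3$. For a vertex $v$, $E(v)$ denotes the set of edges incident with $v$; such a star is maximal if not properly contained in another star $E(u)$. A graph $G=(V,E)$ without isolated vertices is equistarable if there is $\varphi:E\to\mathbb{R}_+$ such that for all $F\subseteq E$, $F$ is a maximal star iff $\sum_{e\in F}\varphi(e)=1$.
   Formalization: The edge weights φ take values in the nonnegative rationals rather than in $\mathbb{R}_+$. -}

module Defs where

open import Data.Nat using (ℕ; _≥_)
open import Data.Fin using (Fin; #_; _≟_)
open import Data.Fin.Subset using (Subset; _∈_; _⊂_; ∣_∣)
open import Data.Vec using (Vec; lookup; tabulate; []; _∷_)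
open import Data.Product using (_×_; _,_; proj₁; proj₂; Σ; ∃; ∃-syntax)
open import Data.Sum using (_⊎_)
open import Data.Bool using (if_then_else_)
open import Data.List using (List; foldr; map; allFin)
open import Data.Rational using (ℚ; 0ℚ; 1ℚ; _+_; _≤_)
open import Relation.Nullary using (¬_; Dec)
open import Relation.Nullary.Decidable using (⌊_⌋; _⊎-dec_)
open import Relation.Binary.PropositionalEquality using (_≡_; _≢_)
open import Function.Bundles using (_⇔_)

record Graph : Set where
  field
    n    : ℕ
    m    : ℕ
    ends : Fin m → Fin n × Fin n

module _ (G : Graph) where
  open Graph G

  Incident : Fin m → Fin n → Set
  Incident e v = proj₁ (ends e) ≡ v ⊎ proj₂ (ends e) ≡ v

  incident? : ∀ e v → Dec (Incident e v)
  incident? e v = (proj₁ (ends e) ≟ v) ⊎-dec (proj₂ (ends e) ≟ v)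

  Adj : Fin n → Fin n → Set
  Adj u v = ∃[ e ] (ends e ≡ (u , v) ⊎ ends e ≡ (v , u))

  star : Fin n → Subset m
  star v = tabulate (λ e → ⌊ incident? e v ⌋)

  degree : Fin n → ℕ
  degree v = ∣ star v ∣

  MaximalStar : Subset m → Set
  MaximalStar F = ∃[ v ] (F ≡ star v × (∀ u → ¬ (star v ⊂ star u)))

  weight : (Fin m → ℚ) → Subset m → ℚ
  weight φ F = foldr _+_ 0ℚ (map (λ e → if lookup F e then φ e else 0ℚ) (allFin m))

  NoIsolated : Set
  NoIsolated = ∀ v → ∃[ e ] Incident e v

  Equistarable : Set
  Equistarable = NoIsolated ×
    Σ (Fin m → ℚ) (λ φ → (∀ e → 0ℚ ≤ φ e) × (∀ F → MaximalStar F ⇔ (weight φ F ≡ 1ℚ)))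

  TriangleFree : Set
  TriangleFree = ∀ u v w → ¬ (Adj u v × Adj v w × Adj u w)

  P5Constrained : Set
  P5Constrained = ∀ v₁ v₂ v₃ v₄ v₅ →
    v₁ ≢ v₂ → v₁ ≢ v₃ → v₁ ≢ v₄ → v₁ ≢ v₅ → v₂ ≢ v₃ → v₂ ≢ v₄ → v₂ ≢ v₅ →
    v₃ ≢ v₄ → v₃ ≢ v₅ → v₄ ≢ v₅ →
    Adj v₁ v₂ → Adj v₂ v₃ → Adj v₃ v₄ → Adj v₄ v₅ → degree v₃ ≥ 3

-- Petersen graph: outer 5-cycle 0..4, spokes i–(i+5), inner pentagram 5-7-9-6-8-5
petersenEdges : Vec (Fin 10 × Fin 10) 15
petersenEdges =
  (# 0 , # 1) ∷ (# 1 , # 2) ∷ (# 2 , # 3) ∷ (# 3 , # 4) ∷ (# 4 , # 0) ∷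
  (# 0 , # 5) ∷ (# 1 , # 6) ∷ (# 2 , # 7) ∷ (# 3 , # 8) ∷ (# 4 , # 9) ∷
  (# 5 , # 7) ∷ (# 7 , # 9) ∷ (# 9 , # 6) ∷ (# 6 , # 8) ∷ (# 8 , # 5) ∷ []

Petersen : Graph
Petersen = record { n = 10 ; m = 15 ; ends = lookup petersenEdges }

{-# OPTIONS --safe #-}
module Submission where

-- Let I = {2, 4, 5, 6}, an independent set of the Petersen graph, and M = {01, 38, 79} the
-- edges with no end in I. Summing stars over the six vertices outside I counts the edges of
-- M twice and every other edge once, while summing over I counts every edge outside M once.
-- So for any weighting 2 φ(M) + Σ_{v ∈ I} φ(E v) = Σ_{v ∉ I} φ(E v). The graph is cubic and
-- its stars are pairwise incomparable, so an equistarable weighting gives every star weight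
-- 1, forcing 2 φ(M) + 4 = 6 and hence φ(M) = 1, although M is not a star. Being cubic, the
-- graph is also P₅-constrained; triangle-freeness is checked by enumeration.

open import Defs
open import Algebra.Properties.Group using (∙-cancelʳ)
import Algebra.Solver.CommutativeMonoid as CommutativeMonoidSolver
open import Data.Bool using (if_then_else_)
open import Data.Bool.Properties using () renaming (_≟_ to _≟ᵇ_)
open import Data.Fin using (Fin; #_; _≟_)
open import Data.Fin.Properties using (all?; any?)
open import Data.Fin.Subset using (Subset; _⊂_; ⁅_⁆; _∪_)
open import Data.Fin.Subset.Properties using (_⊂?_)
open import Data.List using (List; []; _∷_; foldr; map; allFin)
open import Data.List.Properties using (map-cong)
open import Data.Nat using (_≥_; _≤?_)
open import Data.Product using (_×_; _,_)
open import Data.Product.Properties using (≡-dec)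
open import Data.Rational using (ℚ; 0ℚ; 1ℚ; ½; _+_; _*_)
open import Data.Rational.Properties using (+-0-group; +-0-commutativeMonoid)
open import Data.Rational.Solver using (module +-*-Solver)
open import Data.Vec using (lookup; tabulate)
import Data.Vec.Properties as Vec
open import Function.Bundles using (Equivalence)
open import Relation.Nullary using (¬_; Dec; ¬?)
open import Relation.Nullary.Decidable using (from-yes; _⊎-dec_; _×-dec_)
open import Relation.Binary.PropositionalEquality using (_≡_; _≢_; refl; sym; cong; module ≡-Reasoning)
open ≡-Reasoning

sumℚ : List ℚ → ℚ
sumℚ = foldr _+_ 0ℚ

double-injective : ∀ {x y : ℚ} → x + x ≡ y + y → x ≡ y
double-injective {x} {y} x+x≡y+y = begin
  x             ≡⟨ half-double x ⟩
  ½ * (x + x)   ≡⟨ cong (½ *_) x+x≡y+y ⟩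
  ½ * (y + y)   ≡⟨ sym (half-double y) ⟩
  y             ∎
  where
  open +-*-Solver
  half-double : ∀ z → z ≡ ½ * (z + z)
  half-double = solve 1 (λ z → z := con ½ :* (z :+ z)) refl

module _ (G : Graph) where
  open Graph G

  adj? : ∀ u v → Dec (Adj G u v)
  adj? u v = any? λ e → ≡-dec _≟_ _≟_ (ends e) (u , v) ⊎-dec ≡-dec _≟_ _≟_ (ends e) (v , u)

  triangleFree? : Dec (TriangleFree G)
  triangleFree? = all? λ u → all? λ v → all? λ w → ¬? (adj? u v ×-dec adj? v w ×-dec adj? u w)

  minDegree≥3⇒P5Constrained : (∀ v → degree G v ≥ 3) → P5Constrained G
  minDegree≥3⇒P5Constrained deg≥3 _ _ v₃ _ _ _ _ _ _ _ _ _ _ _ _ _ _ _ _ = deg≥3 v₃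

  StarsIncomparable : Set
  StarsIncomparable = ∀ u v → ¬ (star G u ⊂ star G v)

  starsIncomparable? : Dec StarsIncomparable
  starsIncomparable? = all? λ u → all? λ v → ¬? (star G u ⊂? star G v)

  starWeights : (Fin m → ℚ) → List (Fin n) → ℚ
  starWeights φ vs = sumℚ (map (λ v → weight G φ (star G v)) vs)

  starWeights-unit : ∀ φ → (∀ v → weight G φ (star G v) ≡ 1ℚ) →
                     ∀ vs → starWeights φ vs ≡ sumℚ (map (λ _ → 1ℚ) vs)
  starWeights-unit _ unit vs = cong sumℚ (map-cong unit vs)

  forcedNonStar⇒¬Equistarable : StarsIncomparable → (F : Subset m) → (∀ v → F ≢ star G v) →
    (∀ φ → (∀ v → weight G φ (star G v) ≡ 1ℚ) → weight G φ F ≡ 1ℚ) → ¬ Equistarable G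
  forcedNonStar⇒¬Equistarable incomparable F notStar forced (_ , φ , _ , equi) =
    let (v , F≡star , _) = Equivalence.from (equi F) (forced φ starWeight≡1) in notStar v F≡star
    where
    starWeight≡1 : ∀ v → weight G φ (star G v) ≡ 1ℚ
    starWeight≡1 v = Equivalence.to (equi (star G v)) (v , refl , λ u → incomparable v u)

  -- Under the environment tabulate φ these expressions evaluate definitionally to the
  -- corresponding weights of any concrete edge set, so the solver proves weight identities.
  module Reflect where
    open CommutativeMonoidSolver +-0-commutativeMonoid public

    weightExpr : Subset m → Expr m
    weightExpr F = foldr _⊕_ id (map (λ e → if lookup F e then var e else id) (allFin m))

    starWeightsExpr : List (Fin n) → Expr m
    starWeightsExpr vs = foldr _⊕_ id (map (λ v → weightExpr (star G v)) vs)

open Graph Petersen using (m)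

petersen-minDegree≥3 : ∀ v → degree Petersen v ≥ 3
petersen-minDegree≥3 = from-yes (all? λ v → 3 ≤? degree Petersen v)

matching : Subset m
matching = ⁅ # 0 ⁆ ∪ ⁅ # 8 ⁆ ∪ ⁅ # 11 ⁆

matching-notStar : ∀ v → matching ≢ star Petersen v
matching-notStar = from-yes (all? λ v → ¬? (Vec.≡-dec _≟ᵇ_ matching (star Petersen v)))

independent outside : List (Fin 10)
independent = # 2 ∷ # 4 ∷ # 5 ∷ # 6 ∷ []
outside     = # 0 ∷ # 1 ∷ # 3 ∷ # 7 ∷ # 8 ∷ # 9 ∷ []

matching-doubleCounted : ∀ φ → weight Petersen φ matching + weight Petersen φ matching
  + starWeights Petersen φ independent ≡ starWeights Petersen φ outside
matching-doubleCounted φ =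
  prove m ((weightExpr matching ⊕ weightExpr matching) ⊕ starWeightsExpr independent)
          (starWeightsExpr outside) (tabulate φ)
  where open Reflect Petersen

matching-forced : ∀ φ → (∀ v → weight Petersen φ (star Petersen v) ≡ 1ℚ) →
                  weight Petersen φ matching ≡ 1ℚ
matching-forced φ unit = double-injective (∙-cancelʳ +-0-group four (wM + wM) (1ℚ + 1ℚ) (begin
  (wM + wM) + four                               ≡⟨ cong (wM + wM +_) (sym (unit-sum independent)) ⟩
  (wM + wM) + starWeights Petersen φ independent ≡⟨ matching-doubleCounted φ ⟩
  starWeights Petersen φ outside                 ≡⟨ unit-sum outside ⟩
  (1ℚ + 1ℚ) + four                               ∎))
  where
  wM four : ℚ
  wM   = weight Petersen φ matching
  four = sumℚ (map (λ _ → 1ℚ) independent)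
  unit-sum : ∀ vs → starWeights Petersen φ vs ≡ sumℚ (map (λ _ → 1ℚ) vs)
  unit-sum = starWeights-unit Petersen φ unit

proposition3 : TriangleFree Petersen × P5Constrained Petersen × ¬ Equistarable Petersen
proposition3 =
  from-yes (triangleFree? Petersen) ,
  minDegree≥3⇒P5Constrained Petersen petersen-minDegree≥3 ,
  forcedNonStar⇒¬Equistarable Petersen (from-yes (starsIncomparable? Petersen))
    matching matching-notStar matching-forced
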